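{- Let $(V,\mathcal{C},I=[1,q],\sigma)$ be an instance. (i) For each non-empty $J\subseteq[1,q]$, and also for $J=\{0\}$, we have $\mathcal{C}_{\max}(V_{\langle J\rangle})\subseteq\mathcal{S}$. (ii) For each $i\in[0,q]$, every solution $S\in\mathcal{S}_i$ is contained in some base in $\mathcal{B}_i$. (iii) $\mathcal{S}_0=\mathcal{B}_0$ and $\mathcal{S}_q=\mathcal{B}_q$.
   Context: A set system $(V,\mathcal{C})$ consists of a finite set $V$ and a family $\mathcal{C}\subseteq2^V$, whose members are called components. For $X\subseteq V$, $\mathcal{C}_{\max}(X)$ is the family of components $Z\subseteq X$ such that no component $W$ satisfies $Z\subsetneq W\subseteq X$. An instance is $(V,\mathcal{C},I,\sigma)$ with $I=[1,q]$ ($q\ge1$) and $\sigma:V\to2^I$. Let $I_\sigma(X)=\bigcap_{v\in X}\sigma(v)$. A solution is a component $X$ such that every component $Y\supsetneq X$ has $I_\sigma(Y)\subsetneq I_\sigma(X)$; $\mathcal{S}$ is the family of solutions. Define $V_{\langle0\rangle}=V$ and $V_{\langle i\rangle}=\{v:i\in\sigma(v)\}$ for $i\in I$. For non-empty $J\subseteq I$, $V_{\langle J\rangle}=\bigcap_{i\in J}V_{\langle i\rangle}$. For $J=\{0\}$, $V_{\langle J\rangle}=V$. $\min I_\sigma(X)\in[0,q]$ is the least item of $I_\sigma(X)$, or $0$ if $I_\sigma(X)=\emptyset$. For $i\in[0,q]$: - $\mathcal{S}_i=\{X\in\mathcal{S}:\min I_\sigma(X)=i\}$; - $\mathcal{B}_i=\{X\in\mathcal{C}_{\max}(V_{\langle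 i\rangle}):\min I_\sigma(X)=i\}$, whose members are called bases. -}

module Defs where

open import Data.Nat using (ℕ; zero; suc)
open import Data.Bool using (Bool; true; false; _∧_; _∨_; not)
open import Data.Fin using (Fin; zero; suc)
open import Data.Vec using (Vec; []; _∷_; tabulate; lookup)
open import Data.Fin.Subset using (Subset; _∈_; _⊆_; _⊂_; ⊤)
open import Data.List using (List)
open import Data.Product using (_×_)
open import Relation.Nullary using (¬_)
open import Relation.Binary.PropositionalEquality using (_≡_)
import Data.List.Membership.Propositional as LM

allᵇ : ∀ {n} → (Fin n → Bool) → Bool
allᵇ {zero}  f = true
allᵇ {suc n} f = f zero ∧ allᵇ (λ v → f (suc v))

-- Ground set V = Fin n; item set I = [1,q] is represented by Fin q,
-- where k : Fin q stands for item (toℕ k + 1).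
-- Indices i ∈ [0,q] are represented by Fin (suc q): zero is 0, suc k is item k.

module _ {n q : ℕ} (σ : Fin n → Subset q) where

  -- I_σ(X) = ⋂_{v ∈ X} σ(v)   (equal to all of I when X = ∅)
  Iσ : Subset n → Subset q
  Iσ X = tabulate λ k → allᵇ (λ v → not (lookup X v) ∨ lookup (σ v) k)

  V⟨_⟩ : Fin (suc q) → Subset n
  V⟨ zero ⟩  = ⊤
  V⟨ suc k ⟩ = tabulate λ v → lookup (σ v) k

  V⟨J⟩ : Subset q → Subset n
  V⟨J⟩ J = tabulate λ v → allᵇ (λ k → not (lookup J k) ∨ lookup (σ v) k)

-- least item of a subset of [1,q], as an element of [0,q]; 0 if empty
minᵇ : ∀ {m} → Subset m → Fin (suc m)
minᵇ [] = zero
minᵇ (true ∷ xs) = suc zero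
minᵇ (false ∷ xs) with minᵇ xs
... | zero  = zero
... | suc j = suc (suc j)

module _ {n : ℕ} (𝒞 : List (Subset n)) where

  IsComponent : Subset n → Set
  IsComponent X = X LM.∈ 𝒞

  InCmax : Subset n → Subset n → Set
  InCmax X Z = IsComponent Z × Z ⊆ X ×
               (∀ W → IsComponent W → Z ⊂ W → ¬ (W ⊆ X))

  module _ {q : ℕ} (σ : Fin n → Subset q) where

    IsSolution : Subset n → Set
    IsSolution X = IsComponent X ×
                   (∀ Y → IsComponent Y → X ⊂ Y → Iσ σ Y ⊂ Iσ σ X)

    minI : Subset n → Fin (suc q)
    minI X = minᵇ (Iσ σ X)

    InS : Fin (suc q) → Subset n → Set
    InS i X = IsSolution X × minI X ≡ i

    InB : Fin (suc q) → Subset n → Set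
    InB i X = InCmax (V⟨_⟩ σ i) X × minI X ≡ i

-- A set cut out by items, A = V⟨T⟩, has the property that Y ⊆ A exactly when T ⊆ Iσ(Y).
-- Hence a component maximal in A cannot be enlarged inside A, and every strict
-- enlargement Y loses an item of T from Iσ: maximal components of such sets are
-- solutions. Conversely a solution X ⊆ A with Iσ(X) ⊆ T is maximal in A, which
-- gives 𝒮₀ ⊆ ℬ₀ (T = ∅) and 𝒮_q ⊆ ℬ_q (T = {q}). Finally every component S lies in
-- V⟨min Iσ(S)⟩, so it extends to a maximal component B there, and S ⊆ B ⊆ V⟨min Iσ(S)⟩
-- forces min Iσ(B) = min Iσ(S).
module Submission where

open import Defs
open import Data.Nat using (ℕ; suc; _≤_; s≤s; z≤n)
open import Data.Bool using (Bool; true; false; not; _∨_)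
open import Data.Fin using (Fin; zero; suc; fromℕ) renaming (_≤_ to _≤ᶠ_)
open import Data.Fin.Properties using (any?; ≤-antisym; ≤fromℕ)
open import Data.Fin.Subset using (Subset; Nonempty; Empty; ⊤; ⊥; ⁅_⁆; _∈_; _∉_; _⊆_; _⊂_; _⊃_)
open import Data.Fin.Subset.Properties using (_∈?_; _⊆?_; _⊂?_; ∉⊥; ⊆⊤; x∈⁅y⁆⇔x≡y)
open import Data.Fin.Subset.Induction using (⊃-wellFounded)
open import Data.Vec using (_∷_; tabulate; lookup; here; there)
open import Data.Vec.Properties using (lookup∘tabulate; []=⇒lookup; lookup⇒[]=)
open import Data.List using (List)
open import Data.List.Relation.Unary.Any using () renaming (any? to anyᴸ?)
open import Data.List.Membership.Propositional using (find; lose)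
open import Data.Product using (_×_; ∃; _,_; proj₁; proj₂)
open import Data.Sum using (_⊎_; inj₁; inj₂)
open import Data.Empty using (⊥-elim)
open import Function using (_∘_)
open import Function.Bundles using (_⇔_; mk⇔; Equivalence)
open import Induction.WellFounded using (Acc; acc)
open import Relation.Nullary using (yes; no; ¬?)
open import Relation.Nullary.Decidable using (_×-dec_; decidable-stable)
open import Relation.Binary.PropositionalEquality using (_≡_; refl; sym; trans; cong; subst)

open Equivalence using (to; from)

allᵇ≡true⇒ : ∀ {m} (f : Fin m → Bool) → allᵇ f ≡ true → ∀ v → f v ≡ true
allᵇ≡true⇒ {suc m} f e v with f zero in f₀
allᵇ≡true⇒ {suc m} f e zero    | true = f₀
allᵇ≡true⇒ {suc m} f e (suc v) | true = allᵇ≡true⇒ (f ∘ suc) e v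

allᵇ≡true⇐ : ∀ {m} (f : Fin m → Bool) → (∀ v → f v ≡ true) → allᵇ f ≡ true
allᵇ≡true⇐ {ℕ.zero} f h = refl
allᵇ≡true⇐ {suc m}  f h rewrite h zero = allᵇ≡true⇐ (f ∘ suc) (h ∘ suc)

not∨≡true⇔ : ∀ {b c} → not b ∨ c ≡ true ⇔ (b ≡ true → c ≡ true)
not∨≡true⇔ {false} = mk⇔ (λ _ ()) (λ _ → refl)
not∨≡true⇔ {true}  = mk⇔ (λ c refl → c) (λ h → h refl)

∈⇔lookup≡true : ∀ {m} {p : Subset m} {x} → x ∈ p ⇔ lookup p x ≡ true
∈⇔lookup≡true = mk⇔ []=⇒lookup (lookup⇒[]= _ _)

∈-tabulate⇔ : ∀ {m} {f : Fin m → Bool} {x} → x ∈ tabulate f ⇔ f x ≡ true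
∈-tabulate⇔ {f = f} {x} = mk⇔
  (λ x∈ → trans (sym (lookup∘tabulate f x)) (to ∈⇔lookup≡true x∈))
  (λ fx → from ∈⇔lookup≡true (trans (lookup∘tabulate f x) fx))

∈-tabulate-allᵇ⇔ : ∀ {m k} (P : Subset m) (F : Fin m → Fin k → Bool) {x} →
                   x ∈ tabulate (λ x → allᵇ λ y → not (lookup P y) ∨ F y x) ⇔
                   (∀ {y} → y ∈ P → F y x ≡ true)
∈-tabulate-allᵇ⇔ P F {x} = mk⇔
  (λ x∈ {y} y∈ → to not∨≡true⇔ (allᵇ≡true⇒ P⇒F (to ∈-tabulate⇔ x∈) y) (to ∈⇔lookup≡true y∈))
  (λ h → from ∈-tabulate⇔ (allᵇ≡true⇐ P⇒F λ y →
           from not∨≡true⇔ λ Py → h (from ∈⇔lookup≡true Py)))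
  where P⇒F = λ y → not (lookup P y) ∨ F y x

⊆⊎∃∉ : ∀ {m} (p r : Subset m) → p ⊆ r ⊎ ∃ λ x → x ∈ p × x ∉ r
⊆⊎∃∉ p r with any? (λ x → (x ∈? p) ×-dec ¬? (x ∈? r))
... | yes (x , x∈p , x∉r) = inj₂ (x , x∈p , x∉r)
... | no ∄x = inj₁ λ {x} x∈p → decidable-stable (x ∈? r) (λ x∉r → ∄x (x , x∈p , x∉r))

minᵇ≡zero⇒Empty : ∀ {m} (P : Subset m) → minᵇ P ≡ zero → Empty P
minᵇ≡zero⇒Empty (true ∷ _)  () _
minᵇ≡zero⇒Empty (false ∷ P) e  (suc x , there x∈P) with minᵇ P in eP
... | zero = minᵇ≡zero⇒Empty P eP (x , x∈P)
minᵇ≡zero⇒Empty (false ∷ P) () _ | suc _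

minᵇ≡suc⇒least : ∀ {m} (P : Subset m) {k} → minᵇ P ≡ suc k →
                 k ∈ P × (∀ {x} → x ∈ P → k ≤ᶠ x)
minᵇ≡suc⇒least (true ∷ _) refl = here , λ _ → z≤n
minᵇ≡suc⇒least (false ∷ P) e with minᵇ P in eP
minᵇ≡suc⇒least (false ∷ P) () | zero
minᵇ≡suc⇒least (false ∷ P) refl | suc j with minᵇ≡suc⇒least P eP
... | j∈P , j≤ = there j∈P , λ { (there x∈P) → s≤s (j≤ x∈P) }

minᵇ-⊆ : ∀ {m} {P Q : Subset m} → Q ⊆ P → (∀ {k} → minᵇ P ≡ suc k → k ∈ Q) →
         minᵇ Q ≡ minᵇ P
minᵇ-⊆ {P = P} {Q} Q⊆P hit with minᵇ P in eP | minᵇ Q in eQ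
... | zero  | zero  = refl
... | zero  | suc j = ⊥-elim (minᵇ≡zero⇒Empty P eP (j , Q⊆P (proj₁ (minᵇ≡suc⇒least Q eQ))))
... | suc k | zero  = ⊥-elim (minᵇ≡zero⇒Empty Q eQ (k , hit refl))
... | suc k | suc j = cong suc (≤-antisym
        (proj₂ (minᵇ≡suc⇒least Q eQ) (hit refl))
        (proj₂ (minᵇ≡suc⇒least P eP) (Q⊆P (proj₁ (minᵇ≡suc⇒least Q eQ)))))

minᵇ≡last⇒⊆⁅last⁆ : ∀ {m} (P : Subset (suc m)) → minᵇ P ≡ suc (fromℕ m) → P ⊆ ⁅ fromℕ m ⁆
minᵇ≡last⇒⊆⁅last⁆ P e {x} x∈P =
  from x∈⁅y⁆⇔x≡y (≤-antisym (≤fromℕ x) (proj₂ (minᵇ≡suc⇒least P e) x∈P))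

module _ {n q : ℕ} (σ : Fin n → Subset q) where

  ∈Iσ⇔ : ∀ {X k} → k ∈ Iσ σ X ⇔ (∀ {v} → v ∈ X → k ∈ σ v)
  ∈Iσ⇔ {X} = mk⇔
    (λ k∈ {v} v∈ → from ∈⇔lookup≡true (to (∈-tabulate-allᵇ⇔ X F) k∈ v∈))
    (λ h → from (∈-tabulate-allᵇ⇔ X F) (to ∈⇔lookup≡true ∘ h))
    where F = λ v k → lookup (σ v) k

  ∈V⟨J⟩⇔ : ∀ {J v} → v ∈ V⟨J⟩ σ J ⇔ J ⊆ σ v
  ∈V⟨J⟩⇔ {J} = mk⇔
    (λ v∈ {k} k∈ → from ∈⇔lookup≡true (to (∈-tabulate-allᵇ⇔ J F) v∈ k∈))
    (λ J⊆ → from (∈-tabulate-allᵇ⇔ J F) (to ∈⇔lookup≡true ∘ J⊆))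
    where F = λ k v → lookup (σ v) k

  ∈V⟨suc⟩⇔ : ∀ {k v} → v ∈ V⟨_⟩ σ (suc k) ⇔ k ∈ σ v
  ∈V⟨suc⟩⇔ = mk⇔ (from ∈⇔lookup≡true ∘ to ∈-tabulate⇔) (from ∈-tabulate⇔ ∘ to ∈⇔lookup≡true)

  Iσ-antimono : ∀ {X Y} → X ⊆ Y → Iσ σ Y ⊆ Iσ σ X
  Iσ-antimono X⊆Y k∈ = from ∈Iσ⇔ (to ∈Iσ⇔ k∈ ∘ X⊆Y)

  ⊆V⟨minᵇIσ⟩ : ∀ X → X ⊆ V⟨_⟩ σ (minᵇ (Iσ σ X))
  ⊆V⟨minᵇIσ⟩ X v∈ with minᵇ (Iσ σ X) in e
  ... | zero  = ⊆⊤ v∈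
  ... | suc k = from ∈V⟨suc⟩⇔ (to ∈Iσ⇔ (proj₁ (minᵇ≡suc⇒least (Iσ σ X) e)) v∈)

  -- A plays the role of V⟨T⟩, up to extensional equality of subsets.
  IsSlice : Subset q → Subset n → Set
  IsSlice T A = ∀ Y → Y ⊆ A ⇔ T ⊆ Iσ σ Y

  V⟨J⟩-isSlice : ∀ J → IsSlice J (V⟨J⟩ σ J)
  V⟨J⟩-isSlice J Y = mk⇔
    (λ Y⊆ {k} k∈ → from ∈Iσ⇔ λ {v} v∈ → to ∈V⟨J⟩⇔ (Y⊆ v∈) k∈)
    (λ J⊆ {v} v∈ → from ∈V⟨J⟩⇔ λ {k} k∈ → to ∈Iσ⇔ (J⊆ k∈) v∈)

  ⊤-isSlice : IsSlice ⊥ ⊤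
  ⊤-isSlice Y = mk⇔ (λ _ {k} → ⊥-elim ∘ ∉⊥) (λ _ {v} → ⊆⊤)

  V⟨suc⟩-isSlice : ∀ k → IsSlice ⁅ k ⁆ (V⟨_⟩ σ (suc k))
  V⟨suc⟩-isSlice k Y = mk⇔
    (λ Y⊆ {k′} k′∈ → subst (_∈ Iσ σ Y) (sym (to x∈⁅y⁆⇔x≡y k′∈))
                  (from ∈Iσ⇔ λ {v} v∈ → to ∈V⟨suc⟩⇔ (Y⊆ v∈)))
    (λ ⁅k⁆⊆ {v} v∈ → from ∈V⟨suc⟩⇔ (to ∈Iσ⇔ (⁅k⁆⊆ (from x∈⁅y⁆⇔x≡y refl)) v∈))

module _ {n : ℕ} (𝒞 : List (Subset n)) where

  extend-to-Cmax : ∀ A {X} → IsComponent 𝒞 X → X ⊆ A → ∃ λ B → InCmax 𝒞 A B × X ⊆ B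
  extend-to-Cmax A {X} = go X (⊃-wellFounded X)
    where
    go : ∀ X → Acc _⊃_ X → IsComponent 𝒞 X → X ⊆ A → ∃ λ B → InCmax 𝒞 A B × X ⊆ B
    go X (acc larger) cX X⊆A with anyᴸ? (λ W → (X ⊂? W) ×-dec (W ⊆? A)) 𝒞
    ... | no ∄W = X , (cX , X⊆A , λ W cW X⊂W W⊆A → ∄W (lose cW (X⊂W , W⊆A))) , λ x∈ → x∈
    ... | yes ∃W with find ∃W
    ...   | W , cW , X⊂W , W⊆A with go W (larger X⊂W) cW W⊆A
    ...     | B , B-max , W⊆B = B , B-max , W⊆B ∘ proj₁ X⊂W

  module _ {q : ℕ} (σ : Fin n → Subset q) where

    Cmax⇒IsSolution : ∀ {T A X} → IsSlice σ T A → InCmax 𝒞 A X → IsSolution 𝒞 σ X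
    Cmax⇒IsSolution {T} {X = X} slice (cX , X⊆A , X-max) = cX , λ Y cY X⊂Y →
      Iσ-antimono σ (proj₁ X⊂Y) , lost-item Y cY X⊂Y
      where
      lost-item : ∀ Y → IsComponent 𝒞 Y → X ⊂ Y → ∃ λ k → k ∈ Iσ σ X × k ∉ Iσ σ Y
      lost-item Y cY X⊂Y with ⊆⊎∃∉ T (Iσ σ Y)
      ... | inj₁ T⊆ = ⊥-elim (X-max Y cY X⊂Y (from (slice Y) T⊆))
      ... | inj₂ (k , k∈T , k∉) = k , to (slice X) X⊆A k∈T , k∉

    IsSolution⇒Cmax : ∀ {T A X} → IsSlice σ T A → IsSolution 𝒞 σ X → X ⊆ A →
                      Iσ σ X ⊆ T → InCmax 𝒞 A X
    IsSolution⇒Cmax slice (cX , X-sol) X⊆A Iσ⊆T = cX , X⊆A , λ W cW X⊂W W⊆A →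
      let _ , k , k∈X , k∉W = X-sol W cW X⊂W in k∉W (to (slice W) W⊆A (Iσ⊆T k∈X))

    extend-to-base : ∀ {S} → IsComponent 𝒞 S → ∃ λ B → InB 𝒞 σ (minI 𝒞 σ S) B × S ⊆ B
    extend-to-base {S} cS with extend-to-Cmax (V⟨_⟩ σ (minI 𝒞 σ S)) cS (⊆V⟨minᵇIσ⟩ σ S)
    ... | B , B-max@(_ , B⊆A , _) , S⊆B = B , (B-max , minI-B) , S⊆B
      where
      minI-B : minI 𝒞 σ B ≡ minI 𝒞 σ S
      minI-B = minᵇ-⊆ (Iσ-antimono σ S⊆B) λ {k} e →
        to (V⟨suc⟩-isSlice σ k B) (subst (λ i → B ⊆ V⟨_⟩ σ i) e B⊆A) (from x∈⁅y⁆⇔x≡y refl)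

lemma2 : (n q : ℕ) → 1 ≤ q → (𝒞 : List (Subset n)) → (σ : Fin n → Subset q) →
    ((∀ (J : Subset q) → Nonempty J → ∀ X → InCmax 𝒞 (V⟨J⟩ σ J) X → IsSolution 𝒞 σ X)
     × (∀ X → InCmax 𝒞 ⊤ X → IsSolution 𝒞 σ X))
    × (∀ (i : Fin (suc q)) → ∀ S → InS 𝒞 σ i S → ∃ λ B → InB 𝒞 σ i B × S ⊆ B)
    × (∀ X → InS 𝒞 σ zero X ⇔ InB 𝒞 σ zero X)
    × (∀ X → InS 𝒞 σ (fromℕ q) X ⇔ InB 𝒞 σ (fromℕ q) X)
lemma2 n (suc q) (s≤s z≤n) 𝒞 σ =
    ( (λ J _ _ → Cmax⇒IsSolution 𝒞 σ (V⟨J⟩-isSlice σ J))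
    , (λ _ → Cmax⇒IsSolution 𝒞 σ (⊤-isSlice σ)) )
  , (λ { _ _ ((cS , _) , refl) → extend-to-base 𝒞 σ cS })
  , (λ X → mk⇔
       (λ (sol , e) → IsSolution⇒Cmax 𝒞 σ (⊤-isSlice σ) sol ⊆⊤
                        (λ k∈ → ⊥-elim (minᵇ≡zero⇒Empty (Iσ σ X) e (_ , k∈))) , e)
       (λ (X-max , e) → Cmax⇒IsSolution 𝒞 σ (⊤-isSlice σ) X-max , e))
  , (λ X → mk⇔
       (λ (sol , e) → IsSolution⇒Cmax 𝒞 σ (V⟨suc⟩-isSlice σ last)
                        sol (subst (λ i → X ⊆ V⟨_⟩ σ i) e (⊆V⟨minᵇIσ⟩ σ X))
                        (minᵇ≡last⇒⊆⁅last⁆ (Iσ σ X) e) , e)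
       (λ (X-max , e) → Cmax⇒IsSolution 𝒞 σ (V⟨suc⟩-isSlice σ last) X-max , e))
  where
  last : Fin (suc q)
  last = fromℕ q
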